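{- For every finite simple graph $G$, the following statements are equivalent: (1) $G$ is a threshold graph; (2) the vertex cover hypergraph $\mathcal{VC}(G)$ is $1$-Sperner; (3) the vertex cover hypergraph $\mathcal{VC}(G)$ is threshold; (4) the vertex cover hypergraph $\mathcal{VC}(G)$ is $2$-asummable.
   Context: A hypergraph $\mathcal{H}=(V,E)$ consists of a finite vertex set $V$ and a set $E$ of subsets of $V$ (hyperedges). $\mathcal{H}$ is $1$-Sperner if every two distinct hyperedges $e,f$ satisfy $\min\{|e\setminus f|,|f\setminus e|\}=1$. A set $X\subseteq V$ is independent in $\mathcal{H}$ if it contains no hyperedge, and dependent otherwise. $\mathcal{H}$ is threshold if there exist $w:V\to\mathbb{Z}_{\ge0}$ and $t\in\mathbb{Z}_{\ge0}$ such that for every $X\subseteq V$, $\sum_{x\in X}w(x)\ge t$ if and only if $X$ contains some hyperedge. $\mathcal{H}$ is $2$-asummable if there are no (not necessarily distinct) independent sets $A_1,A_2$ and dependent sets $B_1,B_2$ with $\chi^{A_1}+\chi^{A_2}=\chi^{B_1}+\chi^{B_2}$, where $\chi^S\in\{0,1\}^V$ is the characteristic vector of $S$. A graph $G=(V,E)$ is threshold if there exist $w:V\to\mathbb{Z}_{\ge0}$ and $t\in\mathbb{Z}_{\ge0}$ such that for every $X\subseteq V$, $\sum_{x\in X}w(x)\le t$ if and only if $X$ is an independent set of $G$. A vertex cover of $G$ is a set $S\subseteq V(G)$ containing at least one endpoint of every edge; the vertex cover hypergraph $\mathcal{VC}(G)$ has vertex set $V(G)$ and as hyperedges exactly the inclusion-minimal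 vertex covers of $G$. -}

module Defs where

open import Data.Nat using (ℕ; zero; suc; _+_; _≤_; _⊓_)
open import Data.Bool using (Bool; true; false)
open import Data.Fin using (Fin)
open import Data.Fin.Subset using (Subset; _∈_; _⊆_; _─_; ∣_∣; inside; outside)
open import Data.Vec using (Vec; []; _∷_; lookup)
open import Data.Product using (Σ; ∃; _×_; _,_)
open import Data.Sum using (_⊎_)
open import Relation.Nullary using (¬_)
open import Relation.Binary.PropositionalEquality using (_≡_; _≢_)
open import Function.Bundles using (_⇔_)

record Graph (n : ℕ) : Set where
  field
    adj    : Fin n → Fin n → Bool
    sym    : ∀ i j → adj i j ≡ adj j i
    irrefl : ∀ i → adj i i ≡ false
open Graph public

record Hypergraph (n : ℕ) : Set₁ where
  field
    IsEdge : Subset n → Set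
open Hypergraph public

χ : ∀ {n} → Subset n → Fin n → ℕ
χ X i with lookup X i
... | true  = 1
... | false = 0

weight : ∀ {n} → (Fin n → ℕ) → Subset n → ℕ
weight {zero}  w []       = 0
weight {suc n} w (b ∷ X)  = (if b then w Fin.zero else 0) + weight (λ i → w (Fin.suc i)) X
  where open import Data.Bool using (if_then_else_)
        import Data.Fin as Fin

Is1Sperner : ∀ {n} → Hypergraph n → Set
Is1Sperner H = ∀ e f → IsEdge H e → IsEdge H f → e ≢ f →
  (∣ e ─ f ∣ ⊓ ∣ f ─ e ∣) ≡ 1

DependentH : ∀ {n} → Hypergraph n → Subset n → Set
DependentH H X = ∃ λ e → IsEdge H e × e ⊆ X

IndependentH : ∀ {n} → Hypergraph n → Subset n → Set
IndependentH H X = ¬ DependentH H X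

IsThresholdH : ∀ {n} → Hypergraph n → Set
IsThresholdH {n} H = Σ (Fin n → ℕ) λ w → Σ ℕ λ t →
  ∀ X → (t ≤ weight w X) ⇔ DependentH H X

Is2Asummable : ∀ {n} → Hypergraph n → Set
Is2Asummable {n} H = ¬ (Σ (Subset n) λ A₁ → Σ (Subset n) λ A₂ →
  Σ (Subset n) λ B₁ → Σ (Subset n) λ B₂ →
  IndependentH H A₁ × IndependentH H A₂ ×
  DependentH H B₁ × DependentH H B₂ ×
  (∀ i → χ A₁ i + χ A₂ i ≡ χ B₁ i + χ B₂ i))

IndependentG : ∀ {n} → Graph n → Subset n → Set
IndependentG G X = ∀ i j → i ∈ X → j ∈ X → adj G i j ≡ false

IsThresholdG : ∀ {n} → Graph n → Set
IsThresholdG {n} G = Σ (Fin n → ℕ) λ w → Σ ℕ λ t →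
  ∀ X → (weight w X ≤ t) ⇔ IndependentG G X

IsVertexCover : ∀ {n} → Graph n → Subset n → Set
IsVertexCover G S = ∀ i j → adj G i j ≡ true → i ∈ S ⊎ j ∈ S

IsMinimalVertexCover : ∀ {n} → Graph n → Subset n → Set
IsMinimalVertexCover G S =
  IsVertexCover G S × (∀ T → T ⊆ S → IsVertexCover G T → T ≡ S)

VC : ∀ {n} → Graph n → Hypergraph n
VC G = record { IsEdge = IsMinimalVertexCover G }

module Submission where

-- Everything runs through alternating configurations: vertices a, b, c, d
-- with edges ab, cd, non-edges ac, bd, a ≢ c and b ≢ d (an induced 2K₂, P₄
-- or C₄).  For AltFree G, "G has no alternating configuration", we prove
--   threshold G ⇒ AltFree G ⇒ threshold G: weights separate edges from
--     non-edges; conversely every nonempty vertex set has an isolated or a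
--     dominating vertex, so weights can be built one vertex at a time;
--   threshold G ⇔ threshold VC(G): X contains a minimal cover iff ∁ X is
--     independent, so the complementary bound works with the same weights;
--   threshold H ⇒ 2-asummable H for every hypergraph, and 2-asummable VC(G)
--     ⇒ AltFree G: trade the complements of the edges ab, cd for those of
--     the non-edges ac, bd;
--   1-Sperner VC(G) ⇔ AltFree G, via private neighbours in minimal covers.

open import Defs renaming (sym to adj-sym)
open import Data.Nat using (ℕ; zero; suc; _+_; _*_; _∸_; _≤_; _<_; _⊓_; z≤n; s≤s; s≤s⁻¹)
open import Data.Nat.Properties using (+-identityʳ; *-zeroʳ; +-comm; *-distribˡ-+; *-distribʳ-+; *-suc; +-commutativeSemigroup; ≤-refl; ≤-reflexive; ≤-trans; ≤-antisym; <⇒≱; ≰⇒>; m≤m+n; n≤1+n; m≤n+m∸n; m≤n+o⇒m∸n≤o; m+n≤o⇒m≤o∸n; m≤o∸n⇒m+n≤o; +-monoʳ-≤; +-mono-≤; +-mono-<; +-cancelˡ-≤; +-cancelʳ-≡; *-monoʳ-≤; *-cancelˡ-≤; *-cancelˡ-<; n≤0⇒n≡0; m⊓n≤m; m⊓n≤n; ⊓-glb)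
open import Algebra.Properties.CommutativeSemigroup +-commutativeSemigroup using (interchange)
open import Data.Nat.Tactic.RingSolver using (solve-∀)
open import Data.Bool using (Bool; true; false; if_then_else_) renaming (_≟_ to _≟ᵇ_)
open import Data.Fin using (Fin; zero; suc; _≟_)
open import Data.Fin.Subset
open import Data.Fin.Subset.Properties
open import Data.Fin.Subset.Induction using (⊂-wellFounded; Acc; acc)
open import Data.Fin.Properties using (any?)
open import Data.Vec using ([]; _∷_; lookup; here; there)
open import Data.Vec.Properties using ([]=⇒lookup; lookup⇒[]=)
open import Data.List using ([]; _∷_; allFin; filter)
import Data.List.Relation.Unary.Any as Any
open import Data.List.Relation.Unary.All as All using (All; []; _∷_)
open import Data.List.Membership.Propositional using () renaming (_∈_ to _∈ˡ_)
open import Data.List.Membership.Propositional.Properties using (∈-allFin; ∈-filter⁺; ∈-filter⁻)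
open import Data.Product using (∃; ∃₂; _×_; _,_; proj₂)
open import Data.Sum using (_⊎_; inj₁; inj₂; [_,_]′)
open import Data.Empty using () renaming (⊥ to Never; ⊥-elim to never)
open import Relation.Nullary using (¬_; Dec; yes; no; contradiction)
open import Relation.Nullary.Decidable using (_×-dec_; ¬?)
open import Relation.Binary.PropositionalEquality
open import Function.Bundles using (_⇔_; mk⇔; Equivalence)
open import Function.Properties.Equivalence using () renaming (trans to ⇔-trans; sym to ⇔-sym)

open Equivalence using (to; from)

∸-≤⇔≤ : ∀ x y t → ((x + y) ∸ t ≤ x) ⇔ (y ≤ t)
∸-≤⇔≤ x y t = mk⇔
  (λ le → +-cancelˡ-≤ x y t (≤-trans (m≤n+m∸n (x + y) t)
            (≤-trans (+-monoʳ-≤ t le) (≤-reflexive (+-comm t x)))))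
  (λ le → m≤n+o⇒m∸n≤o (x + y) t (≤-trans (+-monoʳ-≤ x le) (≤-reflexive (+-comm x t))))

≤-∸⇔≤ : ∀ x y t → t ≤ x + y → (x ≤ (x + y) ∸ t) ⇔ (t ≤ y)
≤-∸⇔≤ x y t t≤x+y = mk⇔
  (λ le → +-cancelˡ-≤ x t y (m≤o∸n⇒m+n≤o x t≤x+y le))
  (λ le → m+n≤o⇒m≤o∸n x (+-monoʳ-≤ x le))

-- Halving inequalities against an odd bound: the doubling step of the
-- weight construction keeps exactly the old comparisons with the old bound.
even-≤-odd : ∀ a t → (2 * a ≤ suc (2 * t)) ⇔ (a ≤ t)
even-≤-odd a t = mk⇔
  (λ le → s≤s⁻¹ (*-cancelˡ-< 2 a (suc t) (≤-trans (s≤s le) (≤-reflexive (sym (*-suc 2 t))))))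
  (λ le → ≤-trans (*-monoʳ-≤ 2 le) (n≤1+n _))

odd-≤-odd : ∀ a t → (suc (2 * a) ≤ suc (2 * t)) ⇔ (a ≤ t)
odd-≤-odd a t = mk⇔ (λ le → *-cancelˡ-≤ 2 (s≤s⁻¹ le)) (λ le → s≤s (*-monoʳ-≤ 2 le))

plus-even-≤⇔zero : ∀ t a → (t + 2 * a ≤ t) ⇔ (a ≡ 0)
plus-even-≤⇔zero t a = mk⇔
  (λ le → n≤0⇒n≡0 (≤-trans (m≤m+n a (a + 0))
            (+-cancelˡ-≤ t (2 * a) 0 (≤-trans le (≤-reflexive (sym (+-identityʳ t)))))))
  (λ { refl → ≤-reflexive (+-identityʳ t) })

-- The exchange identity behind 2-asummability, for 0/1 indicators: if each
-- of four pair-complements is complementary to its pair, the first two and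
-- the last two complements have the same total.
exchange : ∀ x₁ x₂ y₁ y₂ a b c d →
  x₁ + (a + b) ≡ 1 → x₂ + (c + d) ≡ 1 → y₁ + (a + c) ≡ 1 → y₂ + (b + d) ≡ 1 →
  x₁ + x₂ ≡ y₁ + y₂
exchange x₁ x₂ y₁ y₂ a b c d e₁ e₂ e₃ e₄ = +-cancelʳ-≡ (a + b + (c + d)) _ _ (begin
    x₁ + x₂ + (a + b + (c + d))       ≡⟨ regroupˣ x₁ x₂ a b c d ⟩
    (x₁ + (a + b)) + (x₂ + (c + d))   ≡⟨ cong₂ _+_ e₁ e₂ ⟩
    2                                 ≡⟨ cong₂ _+_ e₃ e₄ ⟨
    (y₁ + (a + c)) + (y₂ + (b + d))   ≡⟨ regroupʸ y₁ y₂ a b c d ⟩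
    y₁ + y₂ + (a + b + (c + d))       ∎)
  where
  open ≡-Reasoning
  regroupˣ : ∀ x₁ x₂ a b c d → x₁ + x₂ + (a + b + (c + d)) ≡ (x₁ + (a + b)) + (x₂ + (c + d))
  regroupˣ = solve-∀
  regroupʸ : ∀ y₁ y₂ a b c d → (y₁ + (a + c)) + (y₂ + (b + d)) ≡ y₁ + y₂ + (a + b + (c + d))
  regroupʸ = solve-∀

x∈p─q⇒x∉q : ∀ {n} {x : Fin n} (p q : Subset n) → x ∈ p ─ q → x ∉ q
x∈p─q⇒x∉q (_ ∷ p) (inside  ∷ q) () here
x∈p─q⇒x∉q (_ ∷ p) (inside  ∷ q) (there x∈) (there x∈q) = x∈p─q⇒x∉q p q x∈ x∈q
x∈p─q⇒x∉q (_ ∷ p) (outside ∷ q) (there x∈) (there x∈q) = x∈p─q⇒x∉q p q x∈ x∈q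

module _ {n : ℕ} where

  x∈p-y⇒x≢y : ∀ {x y : Fin n} (p : Subset n) → x ∈ p - y → x ≢ y
  x∈p-y⇒x≢y {y = y} p x∈ refl = x∈p─q⇒x∉q p ⁅ y ⁆ x∈ (x∈⁅x⁆ y)

  x∈p-y⇒x∈p : ∀ {x y : Fin n} (p : Subset n) → x ∈ p - y → x ∈ p
  x∈p-y⇒x∈p {y = y} p = p─q⊆p p ⁅ y ⁆

  x∈p∧x∉p-y⇒x≡y : ∀ {x y : Fin n} {p : Subset n} → x ∈ p → x ∉ p - y → x ≡ y
  x∈p∧x∉p-y⇒x≡y {x} {y} x∈p x∉ with x ≟ y
  ... | yes x≡y = x≡y
  ... | no  x≢y = contradiction (x∈p∧x≢y⇒x∈p-y x∈p x≢y) x∉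

  pair : Fin n → Fin n → Subset n
  pair a b = ⁅ a ⁆ ∪ ⁅ b ⁆

  a∈pair : ∀ a b → a ∈ pair a b
  a∈pair a b = x∈p∪q⁺ (inj₁ (x∈⁅x⁆ a))

  b∈pair : ∀ a b → b ∈ pair a b
  b∈pair a b = x∈p∪q⁺ (inj₂ (x∈⁅x⁆ b))

  pair⁻ : ∀ {a b x} → x ∈ pair a b → x ≡ a ⊎ x ≡ b
  pair⁻ {a} {b} x∈ with x∈p∪q⁻ ⁅ a ⁆ ⁅ b ⁆ x∈
  ... | inj₁ x∈a = inj₁ (x∈⁅y⁆⇒x≡y a x∈a)
  ... | inj₂ x∈b = inj₂ (x∈⁅y⁆⇒x≡y b x∈b)

  HasTwo : Subset n → Set
  HasTwo S = ∃₂ λ x y → x ∈ S × y ∈ S × x ≢ y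

  AtMostOne : Subset n → Set
  AtMostOne S = ∀ {x y} → x ∈ S → y ∈ S → x ≡ y

  hasTwo? : ∀ S → Dec (HasTwo S)
  hasTwo? S = any? λ x → any? λ y → (x ∈? S) ×-dec (y ∈? S) ×-dec ¬? (x ≟ y)

  ¬HasTwo⇒AtMostOne : ∀ {S : Subset n} → ¬ HasTwo S → AtMostOne S
  ¬HasTwo⇒AtMostOne {S} ¬two {x} {y} x∈ y∈ with x ≟ y
  ... | yes x≡y = x≡y
  ... | no  x≢y = contradiction (x , y , x∈ , y∈ , x≢y) ¬two

  1≤∣p∣ : ∀ {S : Subset n} {x} → x ∈ S → 1 ≤ ∣ S ∣
  1≤∣p∣ {S} {x} x∈ = ≤-trans (≤-reflexive (sym (∣⁅x⁆∣≡1 x)))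
    (p⊆q⇒∣p∣≤∣q∣ λ y∈ → subst (_∈ S) (sym (x∈⁅y⁆⇒x≡y x y∈)) x∈)

  2≤∣p∣ : ∀ {S : Subset n} {x y} → x ∈ S → y ∈ S → x ≢ y → 2 ≤ ∣ S ∣
  2≤∣p∣ {S} {x} {y} x∈ y∈ x≢y =
    ≤-trans (s≤s (1≤∣p∣ (x∈p∧x≢y⇒x∈p-y y∈ (≢-sym x≢y)))) (x∈p⇒∣p-x∣<∣p∣ x∈)

  AtMostOne⇒∣p∣≤1 : ∀ {S : Subset n} → AtMostOne S → ∣ S ∣ ≤ 1
  AtMostOne⇒∣p∣≤1 {S} one with nonempty? S
  ... | yes (x , x∈) = ≤-trans (p⊆q⇒∣p∣≤∣q∣ λ y∈ → subst (_∈ ⁅ x ⁆) (one x∈ y∈) (x∈⁅x⁆ x))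
                                (≤-reflexive (∣⁅x⁆∣≡1 x))
  ... | no  empty    = subst (_≤ 1) (sym (trans (cong ∣_∣ (Empty-unique empty)) (∣⊥∣≡0 n))) z≤n

χ-∈ : ∀ {n} {X : Subset n} {i} → i ∈ X → χ X i ≡ 1
χ-∈ {X = X} {i} i∈ with lookup X i | []=⇒lookup i∈
... | .true | refl = refl

χ-∉ : ∀ {n} {X : Subset n} {i} → i ∉ X → χ X i ≡ 0
χ-∉ {X = X} {i} i∉ with lookup X i in eq
... | true  = contradiction (lookup⇒[]= i X eq) i∉
... | false = refl

module _ {n : ℕ} where

  χ-cong : ∀ {X Y : Subset n} {i} → (i ∈ X → i ∈ Y) → (i ∈ Y → i ∈ X) → χ X i ≡ χ Y i
  χ-cong {X} {Y} {i} X→Y Y→X with i ∈? X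
  ... | yes i∈X = trans (χ-∈ i∈X) (sym (χ-∈ (X→Y i∈X)))
  ... | no  i∉X = trans (χ-∉ i∉X) (sym (χ-∉ (λ i∈Y → i∉X (Y→X i∈Y))))

  χ-∁ : ∀ (X : Subset n) i → χ X i + χ (∁ X) i ≡ 1
  χ-∁ X i with i ∈? X
  ... | yes i∈ = cong₂ _+_ (χ-∈ i∈) (χ-∉ (x∈p⇒x∉∁p i∈))
  ... | no  i∉ = cong₂ _+_ (χ-∉ i∉) (χ-∈ (x∉p⇒x∈∁p i∉))

  χ-pair : ∀ {a b : Fin n} → a ≢ b → ∀ i → χ (pair a b) i ≡ χ ⁅ a ⁆ i + χ ⁅ b ⁆ i
  χ-pair {a} {b} a≢b i with i ≟ a | i ≟ b
  ... | yes refl | yes refl = contradiction refl a≢b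
  ... | yes refl | no  i≢b = trans (χ-∈ (a∈pair a b)) (sym (cong₂ _+_ (χ-∈ (x∈⁅x⁆ a)) (χ-∉ (x≢y⇒x∉⁅y⁆ i≢b))))
  ... | no  i≢a  | yes refl = trans (χ-∈ (b∈pair a b)) (sym (cong₂ _+_ (χ-∉ (x≢y⇒x∉⁅y⁆ i≢a)) (χ-∈ (x∈⁅x⁆ b))))
  ... | no  i≢a  | no  i≢b  = trans (χ-∉ (λ i∈ → [ i≢a , i≢b ]′ (pair⁻ i∈)))
                                    (sym (cong₂ _+_ (χ-∉ (x≢y⇒x∉⁅y⁆ i≢a)) (χ-∉ (x≢y⇒x∉⁅y⁆ i≢b))))


  χ-remove : ∀ {X : Subset n} {v} → v ∈ X → ∀ i → χ X i ≡ χ ⁅ v ⁆ i + χ (X - v) i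
  χ-remove {X} {v} v∈ i with i ≟ v
  ... | yes refl = trans (χ-∈ v∈) (sym (cong₂ _+_ (χ-∈ (x∈⁅x⁆ v)) (χ-∉ (λ v∈' → x∈p-y⇒x≢y X v∈' refl))))
  ... | no  i≢v  = trans (χ-cong (λ i∈ → x∈p∧x≢y⇒x∈p-y i∈ i≢v) (x∈p-y⇒x∈p X))
                         (sym (cong (_+ χ (X - v) i) (χ-∉ (x≢y⇒x∉⁅y⁆ i≢v))))

-- Weights add like characteristic vectors: the weight of a set is the
-- scalar product of its characteristic vector with the weight vector.
weight-additive : ∀ {n} (w : Fin n → ℕ) (A B C D : Subset n) →
  (∀ i → χ A i + χ B i ≡ χ C i + χ D i) →
  weight w A + weight w B ≡ weight w C + weight w D
weight-additive {zero}  w [] [] [] [] _ = refl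
weight-additive {suc n} w (a ∷ A) (b ∷ B) (c ∷ C) (d ∷ D) eq = begin
    (h a + weight w′ A) + (h b + weight w′ B)  ≡⟨ interchange (h a) _ (h b) _ ⟩
    (h a + h b) + (weight w′ A + weight w′ B)  ≡⟨ cong₂ _+_ heads tails ⟩
    (h c + h d) + (weight w′ C + weight w′ D)  ≡⟨ interchange (h c) (h d) _ _ ⟩
    (h c + weight w′ C) + (h d + weight w′ D)  ∎
  where
  open ≡-Reasoning
  w′ : Fin n → ℕ
  w′ i = w (suc i)
  h : Bool → ℕ
  h x = if x then w zero else 0
  head : ∀ x (X : Subset n) → h x ≡ χ (x ∷ X) zero * w zero
  head true  X = sym (+-identityʳ (w zero))
  head false X = refl
  heads : h a + h b ≡ h c + h d
  heads = begin
    h a + h b                                          ≡⟨ cong₂ _+_ (head a A) (head b B) ⟩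
    χ (a ∷ A) zero * w zero + χ (b ∷ B) zero * w zero  ≡⟨ *-distribʳ-+ (w zero) (χ (a ∷ A) zero) (χ (b ∷ B) zero) ⟨
    (χ (a ∷ A) zero + χ (b ∷ B) zero) * w zero         ≡⟨ cong (_* w zero) (eq zero) ⟩
    (χ (c ∷ C) zero + χ (d ∷ D) zero) * w zero         ≡⟨ *-distribʳ-+ (w zero) (χ (c ∷ C) zero) (χ (d ∷ D) zero) ⟩
    χ (c ∷ C) zero * w zero + χ (d ∷ D) zero * w zero  ≡⟨ cong₂ _+_ (head c C) (head d D) ⟨
    h c + h d                                          ∎
  tails : weight w′ A + weight w′ B ≡ weight w′ C + weight w′ D
  tails = weight-additive w′ A B C D (λ i → eq (suc i))

weight-⊥ : ∀ {n} (w : Fin n → ℕ) → weight w ⊥ ≡ 0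
weight-⊥ {zero}  w = refl
weight-⊥ {suc n} w = weight-⊥ (λ i → w (suc i))

weight-⁅⁆ : ∀ {n} (w : Fin n → ℕ) v → weight w ⁅ v ⁆ ≡ w v
weight-⁅⁆ w zero    = trans (cong (w zero +_) (weight-⊥ (λ i → w (suc i)))) (+-identityʳ (w zero))
weight-⁅⁆ w (suc v) = weight-⁅⁆ (λ i → w (suc i)) v

weight-cong : ∀ {n} (f g : Fin n → ℕ) (X : Subset n) →
  (∀ {i} → i ∈ X → f i ≡ g i) → weight f X ≡ weight g X
weight-cong {zero}  f g []          _  = refl
weight-cong {suc n} f g (true  ∷ X) eq =
  cong₂ _+_ (eq here) (weight-cong (λ i → f (suc i)) (λ i → g (suc i)) X (λ i∈ → eq (there i∈)))
weight-cong {suc n} f g (false ∷ X) eq =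
  weight-cong (λ i → f (suc i)) (λ i → g (suc i)) X (λ i∈ → eq (there i∈))

weight-scale : ∀ {n} k (w : Fin n → ℕ) (X : Subset n) → weight (λ i → k * w i) X ≡ k * weight w X
weight-scale {zero}  k w []          = sym (*-zeroʳ k)
weight-scale {suc n} k w (true  ∷ X) =
  trans (cong (k * w zero +_) (weight-scale k (λ i → w (suc i)) X)) (sym (*-distribˡ-+ k (w zero) _))
weight-scale {suc n} k w (false ∷ X) = weight-scale k (λ i → w (suc i)) X

module _ {n : ℕ} (w : Fin n → ℕ) where

  weight-split : ∀ (A C D : Subset n) → (∀ i → χ A i ≡ χ C i + χ D i) →
    weight w A ≡ weight w C + weight w D
  weight-split A C D eq = begin
    weight w A                 ≡⟨ +-identityʳ (weight w A) ⟨
    weight w A + 0             ≡⟨ cong (weight w A +_) (weight-⊥ w) ⟨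
    weight w A + weight w ⊥    ≡⟨ weight-additive w A ⊥ C D (λ i → trans (cong (χ A i +_) (χ-∉ (∉⊥ {x = i})))
                                                                  (trans (+-identityʳ _) (eq i))) ⟩
    weight w C + weight w D    ∎
    where open ≡-Reasoning

  weight-remove : ∀ {X v} → v ∈ X → weight w X ≡ w v + weight w (X - v)
  weight-remove {X} {v} v∈ =
    trans (weight-split X ⁅ v ⁆ (X - v) (χ-remove v∈)) (cong (_+ weight w (X - v)) (weight-⁅⁆ w v))

  weight-pair : ∀ {a b} → a ≢ b → weight w (pair a b) ≡ w a + w b
  weight-pair {a} {b} a≢b =
    trans (weight-split (pair a b) ⁅ a ⁆ ⁅ b ⁆ (χ-pair a≢b)) (cong₂ _+_ (weight-⁅⁆ w a) (weight-⁅⁆ w b))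

  weight-∁ : ∀ X → weight w ⊤ ≡ weight w X + weight w (∁ X)
  weight-∁ X = weight-split ⊤ X (∁ X) (λ i → trans (χ-∈ (∈⊤ {x = i})) (sym (χ-∁ X i)))

  weight-≥ : ∀ {X v} → v ∈ X → w v ≤ weight w X
  weight-≥ {X} {v} v∈ = ≤-trans (m≤m+n (w v) (weight w (X - v))) (≤-reflexive (sym (weight-remove v∈)))

  weight≡0⇔Empty : ∀ {Y} → (∀ {u} → u ∈ Y → 1 ≤ w u) → (weight w Y ≡ 0) ⇔ Empty Y
  weight≡0⇔Empty {Y} positive = mk⇔
    (λ zero-weight (u , u∈) → <⇒≱ (≤-trans (positive u∈) (weight-≥ u∈)) (≤-reflexive zero-weight))
    (λ empty → trans (cong (weight w) (Empty-unique empty)) (weight-⊥ w))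

-- Every set with a decidable, upward-closed property P contains an
-- inclusion-minimal set with P: remove elements while P survives
-- (well-founded induction along ⊂).
module _ {n : ℕ} {P : Subset n → Set} (P? : ∀ S → Dec (P S))
         (P-mono : ∀ {S T} → P S → S ⊆ T → P T) where

  Minimal : Subset n → Set
  Minimal e = P e × (∀ T → T ⊆ e → P T → T ≡ e)

  minimal-below : ∀ X → P X → ∃ λ e → Minimal e × e ⊆ X
  minimal-below X = go X (⊂-wellFounded X)
    where
    go : ∀ X → Acc _⊂_ X → P X → ∃ λ e → Minimal e × e ⊆ X
    go X (acc smaller) pX with any? (λ u → (u ∈? X) ×-dec P? (X - u))
    ... | yes (u , u∈ , pX-u) with go (X - u) (smaller (x∈p⇒p-x⊂p u∈)) pX-u
    ...   | e , e-minimal , e⊆ = e , e-minimal , λ x∈ → x∈p-y⇒x∈p X (e⊆ x∈)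
    go X (acc smaller) pX | no irreducible = X , (pX , minimal) , λ x∈ → x∈
      where
      -- A proper subset T with P would leave P true after removing a
      -- vertex of X outside T.
      minimal : ∀ T → T ⊆ X → P T → T ≡ X
      minimal T T⊆X pT = ⊆-antisym T⊆X X⊆T
        where
        X⊆T : X ⊆ T
        X⊆T {i} i∈X with i ∈? T
        ... | yes i∈T = i∈T
        ... | no  i∉T = contradiction
          (i , i∈X , P-mono pT (λ {x} x∈T → x∈p∧x≢y⇒x∈p-y (T⊆X x∈T) λ { refl → i∉T x∈T }))
          irreducible

module _ {A : Set} (_≼_ : A → A → Set) (≼-refl : ∀ x → x ≼ x)
         (≼-trans : ∀ {x y z} → x ≼ y → y ≼ z → x ≼ z) (≼-total : ∀ x y → x ≼ y ⊎ y ≼ x) where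

  maximum : ∀ x xs → ∃ λ m → m ∈ˡ (x ∷ xs) × All (_≼ m) (x ∷ xs)
  maximum x [] = x , Any.here refl , ≼-refl x ∷ []
  maximum x (y ∷ ys) with maximum y ys
  ... | m , m∈ , below-m with ≼-total x m
  ...   | inj₁ x≼m = m , Any.there m∈ , x≼m ∷ below-m
  ...   | inj₂ m≼x = x , Any.here refl , ≼-refl x ∷ All.map (λ u≼m → ≼-trans u≼m m≼x) below-m

module _ {n : ℕ} (G : Graph n) where

  edge⇒≢ : ∀ {a b} → adj G a b ≡ true → a ≢ b
  edge⇒≢ {a} ab refl with trans (sym ab) (irrefl G a)
  ... | ()

  Uncovered : Subset n → Set
  Uncovered S = ∃₂ λ i j → adj G i j ≡ true × i ∉ S × j ∉ S

  uncovered? : ∀ S → Dec (Uncovered S)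
  uncovered? S = any? λ i → any? λ j → (adj G i j ≟ᵇ true) ×-dec (¬? (i ∈? S)) ×-dec (¬? (j ∈? S))

  cover⇔¬uncovered : ∀ S → IsVertexCover G S ⇔ (¬ Uncovered S)
  cover⇔¬uncovered S = mk⇔
    (λ cover (i , j , ij , i∉ , j∉) → [ i∉ , j∉ ]′ (cover i j ij))
    (λ ¬unc i j ij → case-out i j ij ¬unc)
    where
    case-out : ∀ i j → adj G i j ≡ true → ¬ Uncovered S → i ∈ S ⊎ j ∈ S
    case-out i j ij ¬unc with i ∈? S | j ∈? S
    ... | yes i∈ | _      = inj₁ i∈
    ... | no  _  | yes j∈ = inj₂ j∈
    ... | no  i∉ | no  j∉ = contradiction (i , j , ij , i∉ , j∉) ¬unc

  cover? : ∀ S → Dec (IsVertexCover G S)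
  cover? S with uncovered? S
  ... | yes unc = no λ cover → to (cover⇔¬uncovered S) cover unc
  ... | no ¬unc = yes (from (cover⇔¬uncovered S) ¬unc)

  cover-mono : ∀ {S T} → IsVertexCover G S → S ⊆ T → IsVertexCover G T
  cover-mono cover S⊆T i j ij with cover i j ij
  ... | inj₁ i∈ = inj₁ (S⊆T i∈)
  ... | inj₂ j∈ = inj₂ (S⊆T j∈)

  outside-cover : ∀ {S i j} → IsVertexCover G S → i ∉ S → j ∉ S → adj G i j ≡ false
  outside-cover {S} {i} {j} cover i∉ j∉ with adj G i j in ij
  ... | false = refl
  ... | true  = contradiction (i , j , ij , i∉ , j∉) (to (cover⇔¬uncovered S) cover)

  cover-right : ∀ {S a b} → IsVertexCover G S → adj G a b ≡ true → a ∉ S → b ∈ S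
  cover-right {a = a} {b} cover ab a∉ = [ (λ a∈ → contradiction a∈ a∉) , (λ b∈ → b∈) ]′ (cover a b ab)

  cover-left : ∀ {S a b} → IsVertexCover G S → adj G a b ≡ true → b ∉ S → a ∈ S
  cover-left {a = a} {b} cover ab b∉ = [ (λ a∈ → a∈) , (λ b∈ → contradiction b∈ b∉) ]′ (cover a b ab)

  cover⇔independent∁ : ∀ X → IsVertexCover G X ⇔ IndependentG G (∁ X)
  cover⇔independent∁ X = mk⇔
    (λ cover i j i∈ j∈ → outside-cover cover (x∈∁p⇒x∉p i∈) (x∈∁p⇒x∉p j∈))
    (λ indep → from (cover⇔¬uncovered X) λ (i , j , ij , i∉ , j∉) →
       contradiction (trans (sym ij) (indep i j (x∉p⇒x∈∁p i∉) (x∉p⇒x∈∁p j∉))) λ ())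

  independent⇔cover∁ : ∀ Y → IndependentG G Y ⇔ IsVertexCover G (∁ Y)
  independent⇔cover∁ Y = mk⇔
    (λ indep → from (cover⇔¬uncovered (∁ Y)) λ (i , j , ij , i∉ , j∉) →
       contradiction (trans (sym ij) (indep i j (x∉∁p⇒x∈p i∉) (x∉∁p⇒x∈p j∉))) λ ())
    (λ cover i j i∈ j∈ → outside-cover cover (x∈p⇒x∉∁p i∈) (x∈p⇒x∉∁p j∈))

  dependent⇔cover : ∀ X → DependentH (VC G) X ⇔ IsVertexCover G X
  dependent⇔cover X = mk⇔
    (λ (e , (e-cover , _) , e⊆X) → cover-mono e-cover e⊆X)
    (minimal-below cover? cover-mono X)

  dependent⇔independent∁ : ∀ X → DependentH (VC G) X ⇔ IndependentG G (∁ X)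
  dependent⇔independent∁ X = ⇔-trans (dependent⇔cover X) (cover⇔independent∁ X)

  -- Every vertex u of a minimal cover e has a private neighbour: a
  -- neighbour outside e (otherwise e - u would still be a cover).
  private-neighbour : ∀ {e u} → IsMinimalVertexCover G e → u ∈ e →
    ∃ λ z → adj G u z ≡ true × z ∉ e
  private-neighbour {e} {u} (e-cover , e-minimal) u∈ with uncovered? (e - u)
  ... | no ¬unc = contradiction (subst (u ∈_) (sym e-u≡e) u∈) λ u∈′ → x∈p-y⇒x≢y e u∈′ refl
    where
    e-u≡e : e - u ≡ e
    e-u≡e = e-minimal (e - u) (p─q⊆p e ⁅ u ⁆) (from (cover⇔¬uncovered (e - u)) ¬unc)
  ... | yes (i , j , ij , i∉ , j∉) with i ∈? e
  ...   | yes i∈e with x∈p∧x∉p-y⇒x≡y i∈e i∉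
  ...     | refl = j , ij , λ j∈ → edge⇒≢ ij (sym (x∈p∧x∉p-y⇒x≡y j∈ j∉))
  private-neighbour {e} (e-cover , _) _ | yes (i , j , ij , i∉ , j∉) | no i∉e
    with x∈p∧x∉p-y⇒x≡y (cover-right e-cover ij i∉e) j∉
  ... | refl = i , trans (adj-sym G j i) ij , i∉e

  Alternating : Fin n → Fin n → Fin n → Fin n → Set
  Alternating a b c d =
    adj G a b ≡ true × adj G c d ≡ true × adj G a c ≡ false × adj G b d ≡ false × a ≢ c × b ≢ d

  AltFree : Set
  AltFree = ∀ a b c d → ¬ Alternating a b c d

  pair-independent : ∀ {a b} → adj G a b ≡ false → IndependentG G (pair a b)
  pair-independent {a} {b} ab i j i∈ j∈ with pair⁻ i∈ | pair⁻ j∈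
  ... | inj₁ refl | inj₁ refl = irrefl G i
  ... | inj₁ refl | inj₂ refl = ab
  ... | inj₂ refl | inj₁ refl = trans (adj-sym G i j) ab
  ... | inj₂ refl | inj₂ refl = irrefl G i

  -- In a threshold graph every edge is heavier than the bound and every
  -- non-edge lighter; an alternating configuration would make the two
  -- edges together both heavier and lighter than the two non-edges.
  threshold⇒altFree : IsThresholdG G → AltFree
  threshold⇒altFree (w , t , threshold) a b c d (ab , cd , ac , bd , a≢c , b≢d) =
    <⇒≱ edges-heavy non-edges-light
    where
    heavy : ∀ {x y} → adj G x y ≡ true → t < w x + w y
    heavy {x} {y} xy = subst (t <_) (weight-pair w (edge⇒≢ xy)) (≰⇒> λ light →
      contradiction (trans (sym xy) (to (threshold (pair x y)) light x y (a∈pair x y) (b∈pair x y))) λ ())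
    light : ∀ {x y} → x ≢ y → adj G x y ≡ false → w x + w y ≤ t
    light x≢y xy = subst (_≤ t) (weight-pair w x≢y) (from (threshold _) (pair-independent xy))
    edges-heavy : t + t < (w a + w b) + (w c + w d)
    edges-heavy = +-mono-< (heavy ab) (heavy cd)
    non-edges-light : (w a + w b) + (w c + w d) ≤ t + t
    non-edges-light = subst (_≤ t + t) (interchange (w a) (w c) (w b) (w d))
                            (+-mono-≤ (light a≢c ac) (light b≢d bd))

  -- Threshold graph ⇔ threshold vertex cover hypergraph: keep the weights
  -- and take the complementary bound, since X is dependent in VC(G) iff
  -- ∁ X is independent in G, and w(X) + w(∁ X) = w(V).
  threshold⇒thresholdVC : IsThresholdG G → IsThresholdH (VC G)
  threshold⇒thresholdVC (w , t , threshold) = w , weight w ⊤ ∸ t , λ X →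
    ⇔-trans (subst (λ W → (W ∸ t ≤ weight w X) ⇔ (weight w (∁ X) ≤ t)) (sym (weight-∁ w X))
                   (∸-≤⇔≤ (weight w X) (weight w (∁ X)) t))
            (⇔-trans (threshold (∁ X)) (⇔-sym (dependent⇔independent∁ X)))

  thresholdVC⇒threshold : IsThresholdH (VC G) → IsThresholdG G
  thresholdVC⇒threshold (w , t , threshold) = w , weight w ⊤ ∸ t , λ Y →
    ⇔-trans (subst (λ W → (weight w Y ≤ W ∸ t) ⇔ (t ≤ weight w (∁ Y))) (sym (weight-∁ w Y))
                   (≤-∸⇔≤ (weight w Y) (weight w (∁ Y)) t (subst (t ≤_) (weight-∁ w Y) t≤W)))
            (⇔-trans (threshold (∁ Y))
                     (⇔-trans (dependent⇔cover (∁ Y)) (⇔-sym (independent⇔cover∁ Y))))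
    where
    t≤W : t ≤ weight w ⊤
    t≤W = from (threshold ⊤) (from (dependent⇔cover ⊤) λ _ _ _ → inj₁ ∈⊤)

-- Every threshold hypergraph is 2-asummable: two independent sets weigh
-- less than 2t, two dependent sets at least 2t, and equal characteristic
-- vector sums give equal weight sums.
threshold⇒2-asummable : ∀ {n} (H : Hypergraph n) → IsThresholdH H → Is2Asummable H
threshold⇒2-asummable H (w , t , threshold) (A₁ , A₂ , B₁ , B₂ , iA₁ , iA₂ , dB₁ , dB₂ , χ-eq) =
  <⇒≱ independent-light dependent-heavy
  where
  below : ∀ {A} → IndependentH H A → weight w A < t
  below iA = ≰⇒> λ le → iA (to (threshold _) le)
  independent-light : weight w A₁ + weight w A₂ < t + t
  independent-light = +-mono-< (below iA₁) (below iA₂)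
  dependent-heavy : t + t ≤ weight w A₁ + weight w A₂
  dependent-heavy = subst (t + t ≤_) (sym (weight-additive w A₁ A₂ B₁ B₂ χ-eq))
                          (+-mono-≤ (from (threshold B₁) dB₁) (from (threshold B₂) dB₂))

module _ {n : ℕ} (G : Graph n) where

  -- An alternating configuration a b c d violates 2-asummability of VC(G):
  -- the complements of the edges ab, cd are independent in VC(G), those of
  -- the non-edges ac, bd are dependent, and both pairs cover each vertex
  -- equally often.
  2-asummable⇒altFree : Is2Asummable (VC G) → AltFree G
  2-asummable⇒altFree asummable a b c d (ab , cd , ac , bd , a≢c , b≢d) =
    asummable (∁ (pair a b) , ∁ (pair c d) , ∁ (pair a c) , ∁ (pair b d) ,
               edge-complement ab , edge-complement cd ,
               non-edge-complement ac , non-edge-complement bd , χ-exchange)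
    where
    edge-complement : ∀ {x y} → adj G x y ≡ true → IndependentH (VC G) (∁ (pair x y))
    edge-complement {x} {y} xy dep with to (dependent⇔cover G _) dep x y xy
    ... | inj₁ x∈ = x∈∁p⇒x∉p x∈ (a∈pair x y)
    ... | inj₂ y∈ = x∈∁p⇒x∉p y∈ (b∈pair x y)
    non-edge-complement : ∀ {x y} → adj G x y ≡ false → DependentH (VC G) (∁ (pair x y))
    non-edge-complement xy =
      from (dependent⇔cover G _) (to (independent⇔cover∁ G _) (pair-independent G xy))
    χ-∁pair : ∀ {x y} → x ≢ y → ∀ i → χ (∁ (pair x y)) i + (χ ⁅ x ⁆ i + χ ⁅ y ⁆ i) ≡ 1
    χ-∁pair {x} {y} x≢y i = begin
      χ (∁ (pair x y)) i + (χ ⁅ x ⁆ i + χ ⁅ y ⁆ i) ≡⟨ cong (χ (∁ (pair x y)) i +_) (χ-pair x≢y i) ⟨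
      χ (∁ (pair x y)) i + χ (pair x y) i          ≡⟨ +-comm (χ (∁ (pair x y)) i) (χ (pair x y) i) ⟩
      χ (pair x y) i + χ (∁ (pair x y)) i          ≡⟨ χ-∁ (pair x y) i ⟩
      1                                            ∎
      where open ≡-Reasoning
    χ-exchange : ∀ i → χ (∁ (pair a b)) i + χ (∁ (pair c d)) i ≡ χ (∁ (pair a c)) i + χ (∁ (pair b d)) i
    χ-exchange i = exchange
      (χ (∁ (pair a b)) i) (χ (∁ (pair c d)) i) (χ (∁ (pair a c)) i) (χ (∁ (pair b d)) i)
      (χ ⁅ a ⁆ i) (χ ⁅ b ⁆ i) (χ ⁅ c ⁆ i) (χ ⁅ d ⁆ i)
      (χ-∁pair (edge⇒≢ G ab) i) (χ-∁pair (edge⇒≢ G cd) i) (χ-∁pair a≢c i) (χ-∁pair b≢d i)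

  -- 1-Sperner ⇔ no alternating configuration.

  minimal-covers-differ : ∀ {e f} → IsMinimalVertexCover G e → IsMinimalVertexCover G f → e ≢ f →
    Nonempty (e ─ f)
  minimal-covers-differ {e} {f} (e-cover , _) (_ , f-minimal) e≢f with nonempty? (e ─ f)
  ... | yes nonempty = nonempty
  ... | no  empty    = contradiction (f-minimal e e⊆f e-cover) e≢f
    where
    e⊆f : e ⊆ f
    e⊆f {x} x∈e with x ∈? f
    ... | yes x∈f = x∈f
    ... | no  x∉f = contradiction (x , x∈p∧x∉q⇒x∈p─q x∈e x∉f) empty

  -- Some minimal cover misses both ends of a non-edge xy: there is one
  -- inside the cover ∁ {x, y}.
  minimal-cover-missing : ∀ {x y} → adj G x y ≡ false →
    ∃ λ e → IsMinimalVertexCover G e × x ∉ e × y ∉ e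
  minimal-cover-missing {x} {y} xy
    with minimal-below (cover? G) (cover-mono G) _ (to (independent⇔cover∁ G _) (pair-independent G xy))
  ... | e , e-min , e⊆ = e , e-min , (λ x∈ → x∈∁p⇒x∉p (e⊆ x∈) (a∈pair x y))
                                   , (λ y∈ → x∈∁p⇒x∉p (e⊆ y∈) (b∈pair x y))

  -- An alternating configuration gives minimal covers e missing a, c and
  -- f missing b, d; then b, d ∈ e ─ f and a, c ∈ f ─ e.
  1-sperner⇒altFree : Is1Sperner (VC G) → AltFree G
  1-sperner⇒altFree sperner a b c d (ab , cd , ac , bd , a≢c , b≢d)
    with minimal-cover-missing ac | minimal-cover-missing bd
  ... | e , e-min@(e-cover , _) , a∉e , c∉e | f , f-min@(f-cover , _) , b∉f , d∉f =
    contradiction (subst (2 ≤_) (sperner e f e-min f-min e≢f)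
                         (⊓-glb (2≤∣p∣ b∈e─f d∈e─f b≢d) (2≤∣p∣ a∈f─e c∈f─e a≢c)))
                  λ { (s≤s ()) }
    where
    b∈e = cover-right G e-cover ab a∉e
    b∈e─f = x∈p∧x∉q⇒x∈p─q b∈e b∉f
    d∈e─f = x∈p∧x∉q⇒x∈p─q (cover-right G e-cover cd c∉e) d∉f
    a∈f─e = x∈p∧x∉q⇒x∈p─q (cover-left G f-cover ab b∉f) a∉e
    c∈f─e = x∈p∧x∉q⇒x∈p─q (cover-left G f-cover cd d∉f) c∉e
    e≢f : e ≢ f
    e≢f e≡f = b∉f (subst (b ∈_) e≡f b∈e)

  module _ (free : AltFree G) where

    no-crossing : ∀ {e f x y x′ y′} → IsVertexCover G e → IsVertexCover G f →
      adj G x y ≡ true → adj G x′ y′ ≡ true → x ∉ f → x′ ∉ f → y ∉ e → y′ ∉ e →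
      x ≢ x′ → y ≢ y′ → Never
    no-crossing {x = x} {y} {x′} {y′} e-cover f-cover xy x′y′ x∉ x′∉ y∉ y′∉ x≢x′ y≢y′ =
      free x y x′ y′ (xy , x′y′ , outside-cover G f-cover x∉ x′∉ , outside-cover G e-cover y∉ y′∉ , x≢x′ , y≢y′)

    -- If e ─ f has two vertices, they share their private neighbour p, and
    -- every vertex of f ─ e is p; so f ─ e has at most one vertex.
    two-forces-one : ∀ {e f} → IsMinimalVertexCover G e → IsMinimalVertexCover G f →
      HasTwo (e ─ f) → AtMostOne (f ─ e)
    two-forces-one {e} {f} e-min@(e-cover , _) f-min@(f-cover , _) (x₁ , x₂ , x₁∈ , x₂∈ , x₁≢x₂)
      with private-neighbour G e-min (p─q⊆p e f x₁∈) | private-neighbour G e-min (p─q⊆p e f x₂∈)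
    ... | p , x₁p , p∉e | p₂ , x₂p₂ , p₂∉e = λ y∈ y′∈ → trans (sole y∈) (sym (sole y′∈))
      where
      x₁∉f = x∈p─q⇒x∉q e f x₁∈
      x₂∉f = x∈p─q⇒x∉q e f x₂∈
      -- Distinct private neighbours would give crossing edges x₁ p, x₂ p₂.
      p₂≡p : p₂ ≡ p
      p₂≡p with p₂ ≟ p
      ... | yes p₂≡p = p₂≡p
      ... | no  p₂≢p = never (no-crossing e-cover f-cover x₂p₂ x₁p x₂∉f x₁∉f p₂∉e p∉e (≢-sym x₁≢x₂) p₂≢p)
      x₂p : adj G x₂ p ≡ true
      x₂p = subst (λ z → adj G x₂ z ≡ true) p₂≡p x₂p₂
      -- A vertex y ≢ p of f ─ e has a private neighbour q ∉ f, and q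
      -- differs from x₁ or from x₂, both of which are adjacent to p.
      sole : ∀ {y} → y ∈ f ─ e → y ≡ p
      sole {y} y∈ with y ≟ p
      ... | yes y≡p = y≡p
      ... | no  y≢p with private-neighbour G f-min (p─q⊆p f e y∈)
      ...   | q , yq , q∉f with q ≟ x₁
      ...     | no  q≢x₁ = never (no-crossing e-cover f-cover (trans (adj-sym G q y) yq) x₁p
                                    q∉f x₁∉f (x∈p─q⇒x∉q f e y∈) p∉e q≢x₁ y≢p)
      ...     | yes refl = never (no-crossing e-cover f-cover (trans (adj-sym G q y) yq) x₂p
                                    q∉f x₂∉f (x∈p─q⇒x∉q f e y∈) p∉e x₁≢x₂ y≢p)

    altFree⇒1-sperner : Is1Sperner (VC G)
    altFree⇒1-sperner e f e-min f-min e≢f = ≤-antisym at-most-one at-least-one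
      where
      at-least-one : 1 ≤ ∣ e ─ f ∣ ⊓ ∣ f ─ e ∣
      at-least-one = ⊓-glb (1≤∣p∣ (proj₂ (minimal-covers-differ e-min f-min e≢f)))
                           (1≤∣p∣ (proj₂ (minimal-covers-differ f-min e-min (≢-sym e≢f))))
      at-most-one : ∣ e ─ f ∣ ⊓ ∣ f ─ e ∣ ≤ 1
      at-most-one with hasTwo? (e ─ f)
      ... | yes two = ≤-trans (m⊓n≤n _ _) (AtMostOne⇒∣p∣≤1 (two-forces-one e-min f-min two))
      ... | no ¬two = ≤-trans (m⊓n≤m _ _) (AtMostOne⇒∣p∣≤1 (¬HasTwo⇒AtMostOne ¬two))

module _ {n : ℕ} (G : Graph n) where

  -- No alternating configuration ⇒ threshold.

  _≼_ : Fin n → Fin n → Set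
  u ≼ v = ∀ z → z ≢ u → z ≢ v → adj G u z ≡ true → adj G v z ≡ true

  ≼-refl : ∀ u → u ≼ u
  ≼-refl u z _ _ uz = uz

  -- Transitivity; the only subtle case is the neighbour z = v of u, where
  -- adjacency of w and v is obtained by passing through u.
  ≼-trans : ∀ {u v w} → u ≼ v → v ≼ w → u ≼ w
  ≼-trans {u} {v} {w} u≼v v≼w z z≢u z≢w uz with z ≟ v
  ... | no  z≢v = v≼w z z≢v z≢w (u≼v z z≢u z≢v uz)
  ... | yes refl with u ≟ w
  ...   | yes refl = uz
  ...   | no  u≢w  = trans (adj-sym G w z) (u≼v w (≢-sym u≢w) (≢-sym z≢w)
                       (trans (adj-sym G u w) (v≼w u (≢-sym z≢u) u≢w (trans (adj-sym G z u) uz))))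

  -- Without alternating configurations the vicinal preorder is total: a
  -- neighbour z of u missed by v and a neighbour z′ of v missed by u would
  -- form one.
  ≼-total : AltFree G → ∀ u v → u ≼ v ⊎ v ≼ u
  ≼-total free u v with any? (λ z → ¬? (z ≟ u) ×-dec ¬? (z ≟ v) ×-dec (adj G u z ≟ᵇ true) ×-dec (adj G v z ≟ᵇ false))
  ... | yes (z , z≢u , z≢v , uz , vz) = inj₂ v≼u
    where
    v≼u : v ≼ u
    v≼u z′ z′≢v z′≢u vz′ with adj G u z′ in uz′
    ... | true  = refl
    ... | false = never (free z u v z′ (trans (adj-sym G z u) uz , vz′ , trans (adj-sym G z v) vz , uz′ ,
                                       z≢v , ≢-sym z′≢u))
  ... | no none = inj₁ u≼v
    where
    u≼v : u ≼ v
    u≼v z z≢u z≢v uz with adj G v z in vz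
    ... | true  = refl
    ... | false = contradiction (z , z≢u , z≢v , uz , vz) none

  Isolated : Subset n → Fin n → Set
  Isolated U v = ∀ {z} → z ∈ U → adj G v z ≡ false

  Dominating : Subset n → Fin n → Set
  Dominating U v = ∀ {z} → z ∈ U → z ≢ v → adj G v z ≡ true

  -- Every nonempty U has an isolated or a dominating vertex: a vicinal
  -- maximum m of U either dominates U, or has a non-neighbour u in U, and
  -- then u ≼ m forces u to be isolated in U.
  isolated-or-dominating : AltFree G → ∀ {U v₀} → v₀ ∈ U →
    ∃ λ v → v ∈ U × (Isolated U v ⊎ Dominating U v)
  isolated-or-dominating free {U} {v₀} v₀∈
    with maximum _≼_ ≼-refl ≼-trans (≼-total free) v₀ (filter (_∈? U) (allFin n))
  ... | m , m∈list , below-m with any? (λ u → (u ∈? U) ×-dec ¬? (u ≟ m) ×-dec (adj G m u ≟ᵇ false))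
  ...   | yes (u , u∈ , u≢m , mu) = u , u∈ , inj₁ isolated
    where
    isolated : Isolated U u
    isolated {z} z∈ with adj G u z in uz
    ... | false = refl
    ... | true  = contradiction (All.lookup below-m (listed z∈) u (edge⇒≢ G uz) u≢m (trans (adj-sym G z u) uz))
                    λ mu′ → contradiction (trans (sym mu) mu′) λ ()
      where
      listed : ∀ {x} → x ∈ U → x ∈ˡ v₀ ∷ filter (_∈? U) (allFin n)
      listed x∈ = Any.there (∈-filter⁺ (_∈? U) (∈-allFin _) x∈)
  ...   | no none = m , m∈U m∈list , inj₂ dominating
    where
    m∈U : m ∈ˡ v₀ ∷ filter (_∈? U) (allFin n) → m ∈ U
    m∈U (Any.here refl) = v₀∈
    m∈U (Any.there m∈)  = proj₂ (∈-filter⁻ (_∈? U) {xs = allFin n} m∈)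
    dominating : Dominating U m
    dominating {z} z∈ z≢m with adj G m z in mz
    ... | true  = refl
    ... | false = contradiction (z , z∈ , z≢m , mz) none

  -- A threshold certificate for the subgraph induced on U, with weights
  -- positive on U (positivity is what lets a dominating vertex be added).
  record ThresholdOn (U : Subset n) : Set where
    field
      w        : Fin n → ℕ
      t        : ℕ
      positive : ∀ {u} → u ∈ U → 1 ≤ w u
      exact    : ∀ {X} → X ⊆ U → (weight w X ≤ t) ⇔ IndependentG G X

  thresholdOn-empty : ∀ {U} → Empty U → ThresholdOn U
  thresholdOn-empty {U} empty = record
    { w        = λ _ → 1
    ; t        = 0
    ; positive = λ u∈ → contradiction (_ , u∈) empty
    ; exact    = λ X⊆U → mk⇔
        (λ _ i _ i∈ _ → contradiction (i , X⊆U i∈) empty)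
        (λ _ → ≤-reflexive (from (weight≡0⇔Empty (λ _ → 1) λ _ → ≤-refl) λ (x , x∈) → empty (x , X⊆U x∈)))
    }

  -- Adding a vertex v to a certificate for U - v: double the old weights,
  -- give v the weight c ≥ 1, and use the odd bound 2t + 1.
  module AddVertex {U v} (v∈U : v ∈ U) (C : ThresholdOn (U - v)) (c : ℕ) (1≤c : 1 ≤ c) where
    open ThresholdOn C

    w⁺ : Fin n → ℕ
    w⁺ i with i ≟ v
    ... | yes _ = c
    ... | no  _ = 2 * w i

    t⁺ : ℕ
    t⁺ = suc (2 * t)

    w⁺-v : w⁺ v ≡ c
    w⁺-v with v ≟ v
    ... | yes _   = refl
    ... | no  v≢v = contradiction refl v≢v

    w⁺-other : ∀ {i} → i ≢ v → w⁺ i ≡ 2 * w i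
    w⁺-other {i} i≢v with i ≟ v
    ... | yes i≡v = contradiction i≡v i≢v
    ... | no  _   = refl

    positive⁺ : ∀ {u} → u ∈ U → 1 ≤ w⁺ u
    positive⁺ {u} u∈ with u ≟ v
    ... | yes _   = 1≤c
    ... | no  u≢v = ≤-trans (positive (x∈p∧x≢y⇒x∈p-y u∈ u≢v)) (m≤m+n (w u) (w u + 0))

    rest⊆ : ∀ {X} → X ⊆ U → X - v ⊆ U - v
    rest⊆ X⊆U x∈ = x∈p∧x≢y⇒x∈p-y (X⊆U (x∈p-y⇒x∈p _ x∈)) (x∈p-y⇒x≢y _ x∈)

    exact-avoiding : ∀ {X} → X ⊆ U → v ∉ X → (weight w⁺ X ≤ t⁺) ⇔ IndependentG G X
    exact-avoiding {X} X⊆U v∉X = subst (λ W → (W ≤ t⁺) ⇔ IndependentG G X) (sym doubled)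
      (⇔-trans (even-≤-odd (weight w X) t)
               (exact λ x∈ → x∈p∧x≢y⇒x∈p-y (X⊆U x∈) λ { refl → v∉X x∈ }))
      where
      doubled : weight w⁺ X ≡ 2 * weight w X
      doubled = trans (weight-cong w⁺ (λ i → 2 * w i) X λ i∈ → w⁺-other λ { refl → v∉X i∈ })
                      (weight-scale 2 w X)

    weight-containing : ∀ {X} → v ∈ X → weight w⁺ X ≡ c + 2 * weight w (X - v)
    weight-containing {X} v∈X = trans (weight-remove w⁺ v∈X) (cong₂ _+_ w⁺-v (trans
      (weight-cong w⁺ (λ i → 2 * w i) (X - v) λ i∈ → w⁺-other (x∈p-y⇒x≢y X i∈))
      (weight-scale 2 w (X - v))))

    certificate : (∀ {X} → X ⊆ U → v ∈ X → (weight w⁺ X ≤ t⁺) ⇔ IndependentG G X) → ThresholdOn U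
    certificate exact-containing = record { w = w⁺ ; t = t⁺ ; positive = positive⁺ ; exact = exact⁺ }
      where
      exact⁺ : ∀ {X} → X ⊆ U → (weight w⁺ X ≤ t⁺) ⇔ IndependentG G X
      exact⁺ {X} X⊆U with v ∈? X
      ... | yes v∈X = exact-containing X⊆U v∈X
      ... | no  v∉X = exact-avoiding X⊆U v∉X

  -- An isolated vertex, given weight 1, does not affect independence.
  add-isolated : ∀ {U v} → v ∈ U → Isolated U v → ThresholdOn (U - v) → ThresholdOn U
  add-isolated {U} {v} v∈U isolated C = certificate λ {X} X⊆U v∈X →
    subst (λ W → (W ≤ t⁺) ⇔ IndependentG G X) (sym (weight-containing v∈X))
      (⇔-trans (odd-≤-odd (weight w (X - v)) t) (⇔-trans (exact (rest⊆ X⊆U)) (without-v X⊆U)))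
    where
    open ThresholdOn C
    open AddVertex v∈U C 1 ≤-refl
    without-v : ∀ {X} → X ⊆ U → IndependentG G (X - v) ⇔ IndependentG G X
    without-v {X} X⊆U = mk⇔ with-v λ indep i j i∈ j∈ → indep i j (x∈p-y⇒x∈p X i∈) (x∈p-y⇒x∈p X j∈)
      where
      with-v : IndependentG G (X - v) → IndependentG G X
      with-v indep i j i∈ j∈ with i ≟ v | j ≟ v
      ... | yes refl | _        = isolated (X⊆U j∈)
      ... | no  _    | yes refl = trans (adj-sym G i j) (isolated (X⊆U i∈))
      ... | no  i≢v  | no  j≢v  = indep i j (x∈p∧x≢y⇒x∈p-y i∈ i≢v) (x∈p∧x≢y⇒x∈p-y j∈ j≢v)

  -- A dominating vertex, given weight 2t + 1, is independent only of itself.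
  add-dominating : ∀ {U v} → v ∈ U → Dominating U v → ThresholdOn (U - v) → ThresholdOn U
  add-dominating {U} {v} v∈U dominating C = certificate λ {X} X⊆U v∈X →
    subst (λ W → (W ≤ t⁺) ⇔ IndependentG G X) (sym (weight-containing v∈X))
      (⇔-trans (plus-even-≤⇔zero t⁺ (weight w (X - v)))
               (⇔-trans (weight≡0⇔Empty w λ u∈ → positive (rest⊆ X⊆U u∈)) (⇔-sym (alone X⊆U v∈X))))
    where
    open ThresholdOn C
    open AddVertex v∈U C (suc (2 * t)) (s≤s z≤n)
    alone : ∀ {X} → X ⊆ U → v ∈ X → IndependentG G X ⇔ Empty (X - v)
    alone {X} X⊆U v∈X = mk⇔
      (λ indep (x , x∈) → contradiction (indep v x v∈X (x∈p-y⇒x∈p X x∈))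
         λ vx → contradiction (trans (sym (dominating (X⊆U (x∈p-y⇒x∈p X x∈)) (x∈p-y⇒x≢y X x∈))) vx) λ ())
      (λ empty i j i∈ j∈ → subst₂ (λ x y → adj G x y ≡ false) (sym (only-v empty i∈)) (sym (only-v empty j∈))
                                  (irrefl G v))
      where
      only-v : Empty (X - v) → ∀ {i} → i ∈ X → i ≡ v
      only-v empty {i} i∈ with i ≟ v
      ... | yes i≡v = i≡v
      ... | no  i≢v = contradiction (i , x∈p∧x≢y⇒x∈p-y i∈ i≢v) empty

  thresholdOn : AltFree G → ∀ U → ThresholdOn U
  thresholdOn free U = build U (⊂-wellFounded U)
    where
    build : ∀ U → Acc _⊂_ U → ThresholdOn U
    build U (acc smaller) with nonempty? U
    ... | no  empty      = thresholdOn-empty empty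
    ... | yes (v₀ , v₀∈) with isolated-or-dominating free v₀∈
    ...   | v , v∈ , inj₁ isolated   = add-isolated v∈ isolated (build (U - v) (smaller (x∈p⇒p-x⊂p v∈)))
    ...   | v , v∈ , inj₂ dominating = add-dominating v∈ dominating (build (U - v) (smaller (x∈p⇒p-x⊂p v∈)))

  altFree⇒threshold : AltFree G → IsThresholdG G
  altFree⇒threshold free = w , t , λ X → exact λ _ → ∈⊤
    where open ThresholdOn (thresholdOn free ⊤)

theorem3p2 : ∀ {n : ℕ} (G : Graph n) →
    (IsThresholdG G ⇔ Is1Sperner (VC G)) ×
    (IsThresholdG G ⇔ IsThresholdH (VC G)) ×
    (IsThresholdG G ⇔ Is2Asummable (VC G))
theorem3p2 G =
  mk⇔ (λ threshold → altFree⇒1-sperner G (threshold⇒altFree G threshold))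
      (λ sperner → altFree⇒threshold G (1-sperner⇒altFree G sperner)) ,
  mk⇔ (threshold⇒thresholdVC G) (thresholdVC⇒threshold G) ,
  mk⇔ (λ threshold → threshold⇒2-asummable (VC G) (threshold⇒thresholdVC G threshold))
      (λ asummable → altFree⇒threshold G (2-asummable⇒altFree G asummable))
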